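{- Let $F,G$ be fields of characteristic $\neq 2$, and let $G/F$ be a field extension of finite degree $r$. Then the cardinality of $V:=[(G^{*})^2\cap F^{*}]/(F^{*})^2$ is at most $r$. -}

module Defs where

open import Level using (Level; _⊔_)
open import Data.Nat using (ℕ; zero; suc; _≤_)
open import Data.Fin using (Fin)
import Data.Fin as Fin
open import Data.Product using (Σ; ∃; _×_; _,_)
open import Relation.Nullary using (¬_)
open import Relation.Binary.PropositionalEquality using (_≡_)
open import Algebra.Bundles using (CommutativeRing)
open import Algebra.Morphism.Structures using (IsRingHomomorphism)

record Field (c ℓ : Level) : Set (Level.suc (c ⊔ ℓ)) where
  field
    commutativeRing : CommutativeRing c ℓ
  open CommutativeRing commutativeRing public
  field
    0≉1     : ¬ (0# ≈ 1#)
    inverse : ∀ x → ¬ (x ≈ 0#) → Σ Carrier λ y → x * y ≈ 1#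

CharNot2 : ∀ {c ℓ} → Field c ℓ → Set ℓ
CharNot2 K = ¬ ((1# + 1#) ≈ 0#)
  where open Field K

-- A field extension G/F: a ring homomorphism ι : F → G
-- (automatically injective since F is a field).
record Extension {c₁ ℓ₁ c₂ ℓ₂} (F : Field c₁ ℓ₁) (G : Field c₂ ℓ₂)
                 : Set (c₁ ⊔ ℓ₁ ⊔ c₂ ⊔ ℓ₂) where
  field
    ι     : Field.Carrier F → Field.Carrier G
    ι-hom : IsRingHomomorphism (Field.rawRing F) (Field.rawRing G) ι

Σ[_] : ∀ {c ℓ} (K : Field c ℓ) {n : ℕ} → (Fin n → Field.Carrier K) → Field.Carrier K
Σ[ K ] {zero}  f = Field.0# K
Σ[ K ] {suc n} f = Field._+_ K (f Fin.zero) (Σ[ K ] (λ i → f (Fin.suc i)))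

linComb : ∀ {c₁ ℓ₁ c₂ ℓ₂} {F : Field c₁ ℓ₁} {G : Field c₂ ℓ₂} (E : Extension F G)
          {r : ℕ} → (Fin r → Field.Carrier F) → (Fin r → Field.Carrier G) → Field.Carrier G
linComb {G = G} E cs e = Σ[ G ] (λ i → Field._*_ G (Extension.ι E (cs i)) (e i))

IsBasis : ∀ {c₁ ℓ₁ c₂ ℓ₂} {F : Field c₁ ℓ₁} {G : Field c₂ ℓ₂} (E : Extension F G)
          {r : ℕ} → (Fin r → Field.Carrier G) → Set (c₁ ⊔ ℓ₁ ⊔ c₂ ⊔ ℓ₂)
IsBasis {F = F} {G = G} E {r} e =
  (∀ (g : Field.Carrier G) → Σ (Fin r → Field.Carrier F) λ cs → Field._≈_ G g (linComb E cs e))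
  × (∀ (cs : Fin r → Field.Carrier F) → Field._≈_ G (linComb E cs e) (Field.0# G)
       → ∀ i → Field._≈_ F (cs i) (Field.0# F))

HasDegree : ∀ {c₁ ℓ₁ c₂ ℓ₂} {F : Field c₁ ℓ₁} {G : Field c₂ ℓ₂} (E : Extension F G)
            → ℕ → Set (c₁ ⊔ ℓ₁ ⊔ c₂ ⊔ ℓ₂)
HasDegree {G = G} E r = Σ (Fin r → Field.Carrier G) λ e → IsBasis E e

InV : ∀ {c₁ ℓ₁ c₂ ℓ₂} {F : Field c₁ ℓ₁} {G : Field c₂ ℓ₂} (E : Extension F G)
      → Field.Carrier F → Set (ℓ₁ ⊔ c₂ ⊔ ℓ₂)
InV {F = F} {G = G} E a =
  ¬ (Field._≈_ F a (Field.0# F))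
  × Σ (Field.Carrier G) λ g → Field._≈_ G (Field._*_ G g g) (Extension.ι E a)

SameSquareClass : ∀ {c ℓ} (F : Field c ℓ) → Field.Carrier F → Field.Carrier F → Set (c ⊔ ℓ)
SameSquareClass F a b =
  Σ (Field.Carrier F) λ f → ¬ (Field._≈_ F f (Field.0# F))
                          × Field._≈_ F a (Field._*_ F b (Field._*_ F f f))

-- |V| ≤ r : every family of elements of V that are pairwise distinct
-- in V (= distinct classes modulo (F*)²) has at most r members.
CardV≤ : ∀ {c₁ ℓ₁ c₂ ℓ₂} {F : Field c₁ ℓ₁} {G : Field c₂ ℓ₂} (E : Extension F G)
         → ℕ → Set (c₁ ⊔ ℓ₁ ⊔ c₂ ⊔ ℓ₂)
CardV≤ {F = F} E r =
  ∀ (k : ℕ) (a : Fin k → Field.Carrier F)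
  → (∀ i → InV E (a i))
  → (∀ i j → ¬ (i ≡ j) → ¬ SameSquareClass F (a i) (a j))
  → k ≤ r

-- Choose square roots s₁, …, s_k ∈ G of representatives a₁, …, a_k ∈ F* of k
-- distinct classes of V.  The s_i are linearly independent over F, hence k ≤ r.
--
-- For the independence, pick greedily some of the s_i as generators g₁, …, g_m
-- such that no product of a nonempty subfamily lies in F.  Every s_i is then an
-- F-multiple of a subproduct ∏_{l ∈ S_i} g_l, and distinct classes a_i give
-- distinct subsets S_i.  The 2^m subproducts are linearly independent over F, by
-- induction on m: adjoining u = g₁ gives the field F(u) = F ⊕ F u, over which
-- g₂, …, g_m stay independent because (y + z u)² ∈ F forces 2 y z = 0.
--
-- Equality in a field is undecidable, so case distinctions are made under double
-- negation; this is enough because k ≤ r is decidable.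

{-# OPTIONS --safe #-}
module Submission where

open import Defs
open import Level using (Level; _⊔_; 0ℓ)
open import Algebra.Bundles using (CommutativeRing; RawRing)
open import Algebra.Morphism.Structures using (module RingMorphisms)
open import Data.Nat as ℕ using (ℕ; zero; suc; _<_; s≤s; _≤?_)
open import Data.Nat.Properties using (≰⇒>)
open import Data.Fin using (Fin; zero; suc; punchIn; punchOut)
open import Data.Fin.Properties using (punchInᵢ≢i; punchIn-punchOut) renaming (_≟_ to _≟ᶠ_)
open import Data.Fin.Subset using (Subset; inside; outside) renaming (⊥ to ∅)
import Data.Bool as Bool
open import Data.Vec using ([]; _∷_; tail)
open import Data.Vec.Properties using (∷-injectiveʳ; ≡-dec)
open import Data.Maybe using (Maybe; just; nothing)
open import Data.Product using (Σ; ∃-syntax; _×_; _,_; proj₁; proj₂)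
open import Data.Product.Properties using () renaming (≡-dec to ×-≡-dec)
open import Data.Sum using (_⊎_; inj₁; inj₂)
open import Data.Empty using (⊥-elim)
open import Function using (_∘_)
open import Relation.Nullary using (¬_; Dec; yes; no)
open import Relation.Nullary.Negation using (¬¬-map; negated-stable; contradiction)
open import Relation.Nullary.Decidable using (¬¬-excluded-middle; decidable-stable)
open import Relation.Binary.PropositionalEquality as ≡ using (_≡_; _≢_)
open import Relation.Binary.Definitions using (DecidableEquality)

private
  -- The bind of ¬¬-Monad from Relation.Nullary.Negation, generalised to
  -- let the two types live in different universes.
  _>>=_ : ∀ {a b} {A : Set a} {B : Set b} → ¬ ¬ A → (A → ¬ ¬ B) → ¬ ¬ B
  m >>= f = negated-stable (¬¬-map f m)

  return : ∀ {a} {A : Set a} → A → ¬ ¬ A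
  return = contradiction

module IntegerCoefficientSolver {c ℓ} (R : CommutativeRing c ℓ) where
  open CommutativeRing R hiding (zero)
  open import Algebra.Properties.Semiring.Mult semiring using (×-homo-+; ×1-homo-*) renaming (_×_ to _·_)
  open import Algebra.Properties.Ring ring using (-0#≈0#; x[y-z]≈xy-xz; [y-z]x≈yx-zx)
  open import Algebra.Properties.AbelianGroup +-abelianGroup using (⁻¹-∙-comm; ⁻¹-anti-homo‿-)
  open import Algebra.Properties.CommutativeSemigroup +-commutativeSemigroup using (interchange)
  open import Algebra.Solver.Ring.AlmostCommutativeRing using (fromCommutativeRing; _-Raw-AlmostCommutative⟶_)
  open import Relation.Binary.Reasoning.Setoid setoid

  private
    -- (m , n) stands for the integer m - n.  It is kept in lowest terms,
    -- min m n = 0, so that the normal forms computed by the solver are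
    -- syntactically equal exactly when they denote the same polynomial.
    reduce : ℕ → ℕ → ℕ × ℕ
    reduce (suc m) (suc n) = reduce m n
    reduce zero    n       = zero , n
    reduce (suc m) zero    = suc m , zero

    ℤ-rawRing : RawRing 0ℓ 0ℓ
    ℤ-rawRing = record
      { Carrier = ℕ × ℕ
      ; _≈_     = _≡_
      ; _+_     = λ (a , b) (c , d) → reduce (a ℕ.+ c) (b ℕ.+ d)
      ; _*_     = λ (a , b) (c , d) → reduce (a ℕ.* c ℕ.+ b ℕ.* d) (a ℕ.* d ℕ.+ b ℕ.* c)
      ; -_      = λ (a , b) → b , a
      ; 0#      = 0 , 0
      ; 1#      = 1 , 0
      }

    ⟦_⟧ : ℕ × ℕ → Carrier
    ⟦ m , n ⟧ = m · 1# - n · 1#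

    +-minus-interchange : ∀ a b c d → (a + b) - (c + d) ≈ (a - c) + (b - d)
    +-minus-interchange a b c d = begin
      (a + b) - (c + d)      ≈⟨ +-congˡ (⁻¹-∙-comm c d) ⟨
      (a + b) + (- c + - d)  ≈⟨ interchange a b (- c) (- d) ⟩
      (a - c) + (b - d)      ∎

    ⟦reduce⟧ : ∀ m n → ⟦ reduce m n ⟧ ≈ m · 1# - n · 1#
    ⟦reduce⟧ (suc m) (suc n) = begin
      ⟦ reduce m n ⟧                 ≈⟨ ⟦reduce⟧ m n ⟩
      m · 1# - n · 1#                ≈⟨ +-identityˡ _ ⟨
      0# + (m · 1# - n · 1#)         ≈⟨ +-congʳ (-‿inverseʳ 1#) ⟨
      (1# - 1#) + (m · 1# - n · 1#)  ≈⟨ +-minus-interchange 1# (m · 1#) 1# (n · 1#) ⟨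
      (1# + m · 1#) - (1# + n · 1#)  ∎
    ⟦reduce⟧ zero    n    = refl
    ⟦reduce⟧ (suc m) zero = refl

    +-homo : ∀ x y → ⟦ RawRing._+_ ℤ-rawRing x y ⟧ ≈ ⟦ x ⟧ + ⟦ y ⟧
    +-homo (a , b) (c , d) = begin
      ⟦ reduce (a ℕ.+ c) (b ℕ.+ d) ⟧         ≈⟨ ⟦reduce⟧ (a ℕ.+ c) (b ℕ.+ d) ⟩
      (a ℕ.+ c) · 1# - (b ℕ.+ d) · 1#        ≈⟨ +-cong (×-homo-+ 1# a c) (-‿cong (×-homo-+ 1# b d)) ⟩
      (a · 1# + c · 1#) - (b · 1# + d · 1#)  ≈⟨ +-minus-interchange _ _ _ _ ⟩
      ⟦ a , b ⟧ + ⟦ c , d ⟧                  ∎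

    *-homo : ∀ x y → ⟦ RawRing._*_ ℤ-rawRing x y ⟧ ≈ ⟦ x ⟧ * ⟦ y ⟧
    *-homo (a , b) (c , d) = begin
      ⟦ reduce (a ℕ.* c ℕ.+ b ℕ.* d) (a ℕ.* d ℕ.+ b ℕ.* c) ⟧
        ≈⟨ ⟦reduce⟧ (a ℕ.* c ℕ.+ b ℕ.* d) (a ℕ.* d ℕ.+ b ℕ.* c) ⟩
      (a ℕ.* c ℕ.+ b ℕ.* d) · 1# - (a ℕ.* d ℕ.+ b ℕ.* c) · 1#
        ≈⟨ +-cong (·-homo a c b d) (-‿cong (·-homo a d b c)) ⟩
      (A * C + B * D) - (A * D + B * C)  ≈⟨ +-minus-interchange _ _ _ _ ⟩
      (A * C - A * D) + (B * D - B * C)  ≈⟨ +-congˡ (⁻¹-anti-homo‿- (B * C) (B * D)) ⟨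
      (A * C - A * D) - (B * C - B * D)  ≈⟨ +-cong (x[y-z]≈xy-xz A C D) (-‿cong (x[y-z]≈xy-xz B C D)) ⟨
      A * (C - D) - B * (C - D)          ≈⟨ [y-z]x≈yx-zx (C - D) A B ⟨
      (A - B) * (C - D)                  ∎
      where
      A = a · 1#; B = b · 1#; C = c · 1#; D = d · 1#
      ·-homo : ∀ a c b d → (a ℕ.* c ℕ.+ b ℕ.* d) · 1# ≈ a · 1# * c · 1# + b · 1# * d · 1#
      ·-homo a c b d = trans (×-homo-+ 1# (a ℕ.* c) (b ℕ.* d)) (+-cong (×1-homo-* a c) (×1-homo-* b d))

    homomorphism : ℤ-rawRing -Raw-AlmostCommutative⟶ fromCommutativeRing R
    homomorphism = record
      { ⟦_⟧    = ⟦_⟧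
      ; +-homo = +-homo
      ; *-homo = *-homo
      ; -‿homo = λ (a , b) → sym (⁻¹-anti-homo‿- (a · 1#) (b · 1#))
      ; 0-homo = -‿inverseʳ 0#
      ; 1-homo = trans (+-cong (+-identityʳ 1#) -0#≈0#) (+-identityʳ 1#)
      }

    _≟⟦⟧_ : ∀ x y → Maybe (⟦ x ⟧ ≈ ⟦ y ⟧)
    x ≟⟦⟧ y with ×-≡-dec ℕ._≟_ ℕ._≟_ x y
    ... | yes ≡.refl = just refl
    ... | no _       = nothing

  open import Algebra.Solver.Ring ℤ-rawRing (fromCommutativeRing R) homomorphism _≟⟦⟧_ public
    using (solve; _:=_; _:+_; _:*_; :-_; _:-_)

module FieldProperties {c ℓ} (K : Field c ℓ) where
  open Field K hiding (zero)
  open IntegerCoefficientSolver commutativeRing public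
  open import Algebra.Properties.Semiring.Sum semiring public
    using (sum; sum-cong-≋; ∑-distrib-+; ∑-comm; *-distribˡ-sum; *-distribʳ-sum; sum-remove; sum-replicate-zero)
  open import Relation.Binary.Reasoning.Setoid setoid public

  x*y≈1⇒x≉0 : ∀ {x y} → x * y ≈ 1# → ¬ x ≈ 0#
  x*y≈1⇒x≉0 {x} {y} xy≈1 x≈0 = 0≉1 (begin
    0#      ≈⟨ zeroˡ y ⟨
    0# * y  ≈⟨ *-congʳ x≈0 ⟨
    x * y   ≈⟨ xy≈1 ⟩
    1#      ∎)

  x≉0⇒x*y≈0⇒y≈0 : ∀ {x y} → ¬ x ≈ 0# → x * y ≈ 0# → y ≈ 0#
  x≉0⇒x*y≈0⇒y≈0 {x} {y} x≉0 xy≈0 = begin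
    y              ≈⟨ *-identityˡ y ⟨
    1# * y         ≈⟨ *-congʳ x*x⁻¹≈1 ⟨
    x * x⁻¹ * y    ≈⟨ solve 3 (λ x x⁻¹ y → x :* x⁻¹ :* y := x⁻¹ :* (x :* y)) refl x x⁻¹ y ⟩
    x⁻¹ * (x * y)  ≈⟨ *-congˡ xy≈0 ⟩
    x⁻¹ * 0#       ≈⟨ zeroʳ x⁻¹ ⟩
    0#             ∎
    where
    x⁻¹ = proj₁ (inverse x x≉0)
    x*x⁻¹≈1 = proj₂ (inverse x x≉0)

  *-≉0 : ∀ {x y} → ¬ x ≈ 0# → ¬ y ≈ 0# → ¬ x * y ≈ 0#
  *-≉0 x≉0 y≉0 xy≈0 = y≉0 (x≉0⇒x*y≈0⇒y≈0 x≉0 xy≈0)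

  inverse-unique : ∀ {x y z} → x * y ≈ 1# → x * z ≈ 1# → y ≈ z
  inverse-unique {x} {y} {z} xy≈1 xz≈1 = begin
    y            ≈⟨ *-identityʳ y ⟨
    y * 1#       ≈⟨ *-congˡ xz≈1 ⟨
    y * (x * z)  ≈⟨ solve 3 (λ x y z → y :* (x :* z) := z :* (x :* y)) refl x y z ⟩
    z * (x * y)  ≈⟨ *-congˡ xy≈1 ⟩
    z * 1#       ≈⟨ *-identityʳ z ⟩
    z            ∎

  x+x≈0⇒x≈0 : CharNot2 K → ∀ {x} → x + x ≈ 0# → x ≈ 0#
  x+x≈0⇒x≈0 2≉0 {x} x+x≈0 = x≉0⇒x*y≈0⇒y≈0 2≉0 (begin
    (1# + 1#) * x     ≈⟨ distribʳ x 1# 1# ⟩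
    1# * x + 1# * x   ≈⟨ +-cong (*-identityˡ x) (*-identityˡ x) ⟩
    x + x             ≈⟨ x+x≈0 ⟩
    0#                ∎)

  Σ≡sum : ∀ {n} (f : Fin n → Carrier) → Σ[ K ] f ≡ sum f
  Σ≡sum {zero}  f = ≡.refl
  Σ≡sum {suc n} f = ≡.cong (f zero +_) (Σ≡sum (f ∘ suc))

  sum-zero : ∀ {n} {f : Fin n → Carrier} → (∀ i → f i ≈ 0#) → sum f ≈ 0#
  sum-zero {n} f≈0 = trans (sum-cong-≋ f≈0) (sum-replicate-zero n)

  sum-single : ∀ {n} (f : Fin n → Carrier) j → (∀ i → i ≢ j → f i ≈ 0#) → sum f ≈ f j
  sum-single {suc n} f j others≈0 = begin
    sum f                    ≈⟨ sum-remove {i = j} f ⟩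
    f j + sum (f ∘ punchIn j)  ≈⟨ +-congˡ (sum-zero (λ i → others≈0 (punchIn j i) (punchInᵢ≢i j i))) ⟩
    f j + 0#                 ≈⟨ +-identityʳ (f j) ⟩
    f j                      ∎

record Subfield {c ℓ} (G : Field c ℓ) (p : Level) : Set (c ⊔ ℓ ⊔ Level.suc p) where
  open Field G using (Carrier; _≈_; 0#; 1#; _+_; -_; _*_)
  field
    Member         : Carrier → Set p
    ∈-resp-≈       : ∀ {x y} → x ≈ y → Member x → Member y
    0∈             : Member 0#
    1∈             : Member 1#
    +-closed       : ∀ {x y} → Member x → Member y → Member (x + y)
    -‿closed       : ∀ {x} → Member x → Member (- x)
    *-closed       : ∀ {x y} → Member x → Member y → Member (x * y)
    inverse-closed : ∀ {x y} → Member x → x * y ≈ 1# → Member y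

infix 4 _∈_ _∉_

_∈_ : ∀ {c ℓ p} {G : Field c ℓ} → Field.Carrier G → Subfield G p → Set p
x ∈ K = Subfield.Member K x

_∉_ : ∀ {c ℓ p} {G : Field c ℓ} → Field.Carrier G → Subfield G p → Set p
x ∉ K = ¬ x ∈ K

module SubfieldProperties {c ℓ p} {G : Field c ℓ} (K : Subfield G p) where
  open Field G hiding (zero)
  open FieldProperties G
  open Subfield K

  sum-closed : ∀ {n} {f : Fin n → Carrier} → (∀ i → f i ∈ K) → sum f ∈ K
  sum-closed {zero}  f∈K = 0∈
  sum-closed {suc n} f∈K = +-closed (f∈K zero) (sum-closed (f∈K ∘ suc))

module Adjoin {c ℓ p} {G : Field c ℓ} (K : Subfield G p) {u : Field.Carrier G}
              (u²∈K : Field._*_ G u u ∈ K) (u∉K : u ∉ K) where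
  open Field G hiding (zero)
  open FieldProperties G
  open Subfield K
  open import Algebra.Properties.Ring ring using (-0#≈0#)
  open import Algebra.Properties.Group +-group using (x∙y⁻¹≈ε⇒x≈y; ⁻¹-injective)

  HasCoordinates : Carrier → Set (c ⊔ ℓ ⊔ p)
  HasCoordinates x = ∃[ y ] ∃[ z ] y ∈ K × z ∈ K × x ≈ y + z * u

  x≈x+0u : ∀ x → x ≈ x + 0# * u
  x≈x+0u x = sym (trans (+-congˡ (zeroˡ u)) (+-identityʳ x))

  coordinates-unique : ∀ {y z y′ z′} → y ∈ K → z ∈ K → y′ ∈ K → z′ ∈ K →
                       y + z * u ≈ y′ + z′ * u → ¬ ¬ (y ≈ y′ × z ≈ z′)
  coordinates-unique {y} {z} {y′} {z′} y∈K z∈K y′∈K z′∈K eq = ¬¬-map (λ z≈z′ → y≈y′ z≈z′ , z≈z′) ¬z≉z′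
    where
    d = z - z′
    ¬z≉z′ : ¬ ¬ z ≈ z′
    ¬z≉z′ z≉z′ = u∉K (∈-resp-≈ (sym u≈) (*-closed (inverse-closed d∈K d*d⁻¹≈1) (+-closed y′∈K (-‿closed y∈K))))
      where
      d∈K = +-closed z∈K (-‿closed z′∈K)
      d≉0 : ¬ d ≈ 0#
      d≉0 d≈0 = z≉z′ (x∙y⁻¹≈ε⇒x≈y z z′ d≈0)
      d⁻¹ = proj₁ (inverse d d≉0)
      d*d⁻¹≈1 = proj₂ (inverse d d≉0)
      u≈ : u ≈ d⁻¹ * (y′ - y)
      u≈ = begin
        u
          ≈⟨ *-identityˡ u ⟨
        1# * u
          ≈⟨ *-congʳ d*d⁻¹≈1 ⟨
        d * d⁻¹ * u
          ≈⟨ solve 5 (λ z z′ d⁻¹ u y → (z :- z′) :* d⁻¹ :* u := d⁻¹ :* ((y :+ z :* u) :- (y :+ z′ :* u)))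
                     refl z z′ d⁻¹ u y ⟩
        d⁻¹ * ((y + z * u) - (y + z′ * u))
          ≈⟨ *-congˡ (+-congʳ eq) ⟩
        d⁻¹ * ((y′ + z′ * u) - (y + z′ * u))
          ≈⟨ solve 5 (λ d⁻¹ y′ z′ u y → d⁻¹ :* ((y′ :+ z′ :* u) :- (y :+ z′ :* u)) := d⁻¹ :* (y′ :- y))
                     refl d⁻¹ y′ z′ u y ⟩
        d⁻¹ * (y′ - y)
          ∎
    y≈y′ : z ≈ z′ → y ≈ y′
    y≈y′ z≈z′ = begin
      y                        ≈⟨ solve 3 (λ y z u → y := (y :+ z :* u) :- z :* u) refl y z u ⟩
      (y + z * u) - z * u      ≈⟨ +-cong eq (-‿cong (*-congʳ z≈z′)) ⟩
      (y′ + z′ * u) - z′ * u   ≈⟨ solve 3 (λ y′ z′ u → (y′ :+ z′ :* u) :- z′ :* u := y′) refl y′ z′ u ⟩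
      y′                       ∎

  hasCoordinates-resp-≈ : ∀ {x x′} → x ≈ x′ → HasCoordinates x → HasCoordinates x′
  hasCoordinates-resp-≈ x≈x′ (y , z , y∈K , z∈K , x≈) = y , z , y∈K , z∈K , trans (sym x≈x′) x≈

  ∈K⇒hasCoordinates : ∀ {x} → x ∈ K → HasCoordinates x
  ∈K⇒hasCoordinates {x} x∈K = x , 0# , x∈K , 0∈ , x≈x+0u x

  *-hasCoordinates : ∀ {x x′} → HasCoordinates x → HasCoordinates x′ → HasCoordinates (x * x′)
  *-hasCoordinates (y , z , y∈K , z∈K , x≈) (y′ , z′ , y′∈K , z′∈K , x′≈) =
    y * y′ + z * z′ * (u * u) , y * z′ + z * y′ ,
    +-closed (*-closed y∈K y′∈K) (*-closed (*-closed z∈K z′∈K) u²∈K) ,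
    +-closed (*-closed y∈K z′∈K) (*-closed z∈K y′∈K) ,
    trans (*-cong x≈ x′≈)
      (solve 5 (λ y z y′ z′ u → (y :+ z :* u) :* (y′ :+ z′ :* u)
                               := (y :* y′ :+ z :* z′ :* (u :* u)) :+ (y :* z′ :+ z :* y′) :* u)
             refl y z y′ z′ u)

  -- x⁻¹ = x̄ / (x * x̄) for the conjugate x̄ = y - z * u; the norm x * x̄ lies in K
  -- and is nonzero because x̄ ≈ 0 would force y ≈ z ≈ 0.
  inverse-hasCoordinates : ∀ {x w} → HasCoordinates x → x * w ≈ 1# → HasCoordinates w
  inverse-hasCoordinates {x} {w} (y , z , y∈K , z∈K , x≈) xw≈1 =
    hasCoordinates-resp-≈ (inverse-unique (trans (sym (*-assoc x x̄ N⁻¹)) N*N⁻¹≈1) xw≈1)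
      (*-hasCoordinates x̄-coordinates (∈K⇒hasCoordinates (inverse-closed N∈K N*N⁻¹≈1)))
    where
    x̄ = y + - z * u
    x̄-coordinates : HasCoordinates x̄
    x̄-coordinates = y , - z , y∈K , -‿closed z∈K , refl
    N = x * x̄
    N∈K : N ∈ K
    N∈K = ∈-resp-≈ (sym N≈) (+-closed (*-closed y∈K y∈K) (-‿closed (*-closed (*-closed z∈K z∈K) u²∈K)))
      where
      N≈ : N ≈ y * y - z * z * (u * u)
      N≈ = trans (*-congʳ x≈) (solve 3 (λ y z u → (y :+ z :* u) :* (y :+ (:- z) :* u) := y :* y :- z :* z :* (u :* u)) refl y z u)
    N≉0 : ¬ N ≈ 0#
    N≉0 N≈0 = coordinates-unique y∈K (-‿closed z∈K) 0∈ 0∈ (trans x̄≈0 (x≈x+0u 0#)) λ (y≈0 , -z≈0) →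
      x*y≈1⇒x≉0 xw≈1 (begin
        x                ≈⟨ x≈ ⟩
        y + z * u        ≈⟨ +-cong y≈0 (*-congʳ (⁻¹-injective (trans -z≈0 (sym -0#≈0#)))) ⟩
        0# + 0# * u      ≈⟨ x≈x+0u 0# ⟨
        0#               ∎)
      where
      x̄≈0 : x̄ ≈ 0#
      x̄≈0 = x≉0⇒x*y≈0⇒y≈0 (x*y≈1⇒x≉0 xw≈1) N≈0
    N⁻¹ = proj₁ (inverse N N≉0)
    N*N⁻¹≈1 = proj₂ (inverse N N≉0)

  K[u] : Subfield G (c ⊔ ℓ ⊔ p)
  K[u] = record
    { Member         = HasCoordinates
    ; ∈-resp-≈       = hasCoordinates-resp-≈
    ; 0∈             = ∈K⇒hasCoordinates 0∈
    ; 1∈             = ∈K⇒hasCoordinates 1∈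
    ; +-closed       = λ { (y , z , y∈K , z∈K , x≈) (y′ , z′ , y′∈K , z′∈K , x′≈) →
                           y + y′ , z + z′ , +-closed y∈K y′∈K , +-closed z∈K z′∈K ,
                           trans (+-cong x≈ x′≈)
                             (solve 5 (λ y z y′ z′ u → (y :+ z :* u) :+ (y′ :+ z′ :* u) := (y :+ y′) :+ (z :+ z′) :* u)
                                    refl y z y′ z′ u) }
    ; -‿closed       = λ { (y , z , y∈K , z∈K , x≈) → - y , - z , -‿closed y∈K , -‿closed z∈K ,
                           trans (-‿cong x≈) (solve 3 (λ y z u → :- (y :+ z :* u) := (:- y) :+ (:- z) :* u) refl y z u) }
    ; *-closed       = *-hasCoordinates
    ; inverse-closed = inverse-hasCoordinates
    }

  -- The u-coordinate of (y + z * u)² is 2 * y * z.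
  x²∈K⇒x∈K⊎ux∈K : CharNot2 G → ∀ {x} → x ∈ K[u] → x * x ∈ K → ¬ ¬ (x ∈ K ⊎ u * x ∈ K)
  x²∈K⇒x∈K⊎ux∈K 2≉0 {x} (y , z , y∈K , z∈K , x≈) x²∈K = do
    (_ , yz+yz≈0) ← coordinates-unique A∈K (+-closed yz∈K yz∈K) x²∈K 0∈ x²≈
    yes z≈0 ← ¬¬-excluded-middle
      where no z≉0 → return (inj₂ (∈-resp-≈ (sym (u*x≈ (yz≈0⇒y≈0 z≉0 (x+x≈0⇒x≈0 2≉0 yz+yz≈0))))
                                             (*-closed z∈K u²∈K)))
    return (inj₁ (∈-resp-≈ (sym (x≈y z≈0)) y∈K))
    where
    A = y * y + z * z * (u * u)
    A∈K = +-closed (*-closed y∈K y∈K) (*-closed (*-closed z∈K z∈K) u²∈K)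
    yz∈K = *-closed y∈K z∈K
    x²≈ : A + (y * z + y * z) * u ≈ x * x + 0# * u
    x²≈ = begin
      A + (y * z + y * z) * u      ≈⟨ solve 3 (λ y z u → (y :* y :+ z :* z :* (u :* u)) :+ (y :* z :+ y :* z) :* u
                                                      := (y :+ z :* u) :* (y :+ z :* u)) refl y z u ⟩
      (y + z * u) * (y + z * u)    ≈⟨ *-cong x≈ x≈ ⟨
      x * x                        ≈⟨ x≈x+0u (x * x) ⟩
      x * x + 0# * u               ∎
    yz≈0⇒y≈0 : ¬ z ≈ 0# → y * z ≈ 0# → y ≈ 0#
    yz≈0⇒y≈0 z≉0 yz≈0 = x≉0⇒x*y≈0⇒y≈0 z≉0 (trans (*-comm z y) yz≈0)
    x≈y : z ≈ 0# → x ≈ y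
    x≈y z≈0 = trans x≈ (trans (+-congˡ (trans (*-congʳ z≈0) (zeroˡ u))) (+-identityʳ y))
    u*x≈ : y ≈ 0# → u * x ≈ z * (u * u)
    u*x≈ y≈0 = begin
      u * x              ≈⟨ *-congˡ x≈ ⟩
      u * (y + z * u)    ≈⟨ *-congˡ (+-congʳ y≈0) ⟩
      u * (0# + z * u)   ≈⟨ *-congˡ (+-identityˡ _) ⟩
      u * (z * u)        ≈⟨ solve 2 (λ u z → u :* (z :* u) := z :* (u :* u)) refl u z ⟩
      z * (u * u)        ∎

module SquareRoots {c ℓ} (G : Field c ℓ) where
  open Field G hiding (zero)
  open FieldProperties G

  ∏ : ∀ {m} → (Fin m → Carrier) → Subset m → Carrier
  ∏ g []              = 1#
  ∏ g (inside  ∷ S)   = g zero * ∏ (g ∘ suc) S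
  ∏ g (outside ∷ S)   = ∏ (g ∘ suc) S

  ∏-∅ : ∀ {m} (g : Fin m → Carrier) → ∏ g ∅ ≈ 1#
  ∏-∅ {zero}  g = refl
  ∏-∅ {suc m} g = ∏-∅ (g ∘ suc)

  record IndependentSqrts {p m} (K : Subfield G p) (g : Fin m → Carrier) : Set p where
    field
      square∈K : ∀ l → g l * g l ∈ K
      ∏∈K⇒∅    : ∀ S → ∏ g S ∈ K → S ≡ ∅

  module _ {p} (K : Subfield G p) where
    open Subfield K

    ∏²∈K : ∀ {m} {g : Fin m → Carrier} → (∀ l → g l * g l ∈ K) → ∀ S → ∏ g S * ∏ g S ∈ K
    ∏²∈K g²∈K []            = ∈-resp-≈ (sym (*-identityˡ 1#)) 1∈
    ∏²∈K g²∈K (outside ∷ S) = ∏²∈K (g²∈K ∘ suc) S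
    ∏²∈K {g = g} g²∈K (inside ∷ S) =
      ∈-resp-≈ (solve 2 (λ a v → (a :* a) :* (v :* v) := (a :* v) :* (a :* v)) refl (g zero) (∏ (g ∘ suc) S))
               (*-closed (g²∈K zero) (∏²∈K (g²∈K ∘ suc) S))

    ∏-≉0 : ∀ {m} {g : Fin m → Carrier} → IndependentSqrts K g → ∀ S → ¬ ∏ g S ≈ 0#
    ∏-≉0 {g = g} ind S ∏≈0 = 0≉1 (begin
      0#       ≈⟨ ∏≈0 ⟨
      ∏ g S    ≡⟨ ≡.cong (∏ g) (IndependentSqrts.∏∈K⇒∅ ind S (∈-resp-≈ (sym ∏≈0) 0∈)) ⟩
      ∏ g ∅    ≈⟨ ∏-∅ g ⟩
      1#       ∎)

  record Decomposition {p n} (K : Subfield G p) (s : Fin n → Carrier) : Set (c ⊔ ℓ ⊔ p) where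
    field
      rank        : ℕ
      generator   : Fin rank → Carrier
      independent : IndependentSqrts K generator
      support     : Fin n → Subset rank
      scalar      : Fin n → Carrier
      scalar∈K    : ∀ i → scalar i ∈ K
      decomposes  : ∀ i → s i ≈ scalar i * ∏ generator (support i)

  module _ {p} (K : Subfield G p) where
    open Subfield K

    _∈K·∏_ : ∀ {m} → Carrier → (Fin m → Carrier) → Set (c ⊔ ℓ ⊔ p)
    x ∈K·∏ g = ∃[ S ] ∃[ a ] a ∈ K × x ≈ a * ∏ g S

    private
      extend : ∀ {n} {s : Fin (suc n) → Carrier} (D : Decomposition K (s ∘ suc)) →
               s zero ∈K·∏ Decomposition.generator D → Decomposition K s
      extend D (S , a , a∈K , s₀≈) = record
        { rank        = rank
        ; generator   = generator
        ; independent = independent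
        ; support     = λ { zero → S ; (suc i) → support i }
        ; scalar      = λ { zero → a ; (suc i) → scalar i }
        ; scalar∈K    = λ { zero → a∈K ; (suc i) → scalar∈K i }
        ; decomposes  = λ { zero → s₀≈ ; (suc i) → decomposes i }
        }
        where open Decomposition D

      -- s₀ * ∏ g S ∈ K would give s₀ ≈ (s₀ * v) * (v * v)⁻¹ * v for v = ∏ g S.
      new-generator : ∀ {n} {s : Fin (suc n) → Carrier} → s zero * s zero ∈ K → (D : Decomposition K (s ∘ suc)) →
                      ¬ s zero ∈K·∏ Decomposition.generator D → Decomposition K s
      new-generator {s = s} s₀²∈K D s₀∉K·∏ = record
        { rank        = suc rank
        ; generator   = generator′
        ; independent = record
          { square∈K = λ { zero → s₀²∈K ; (suc l) → square∈K l }
          ; ∏∈K⇒∅    = λ { (outside ∷ S) v∈K  → ≡.cong (outside ∷_) (∏∈K⇒∅ S v∈K)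
                         ; (inside ∷ S) s₀v∈K → contradiction (S , s₀∈K·v S s₀v∈K) s₀∉K·∏ } }
        ; support     = λ { zero → inside ∷ ∅ ; (suc i) → outside ∷ support i }
        ; scalar      = λ { zero → 1# ; (suc i) → scalar i }
        ; scalar∈K    = λ { zero → 1∈ ; (suc i) → scalar∈K i }
        ; decomposes  = λ { zero → s₀≈ ; (suc i) → decomposes i }
        }
        where
        open Decomposition D
        open IndependentSqrts independent
        s₀ = s zero
        generator′ : Fin (suc rank) → Carrier
        generator′ zero    = s₀
        generator′ (suc l) = generator l
        s₀≈ : s₀ ≈ 1# * (s₀ * ∏ generator ∅)
        s₀≈ = sym (trans (*-identityˡ _) (trans (*-congˡ (∏-∅ generator)) (*-identityʳ s₀)))
        s₀∈K·v : ∀ S → s₀ * ∏ generator S ∈ K → ∃[ a ] a ∈ K × s₀ ≈ a * ∏ generator S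
        s₀∈K·v S s₀v∈K = s₀ * v * β , *-closed s₀v∈K β∈K , (begin
          s₀                  ≈⟨ *-identityʳ s₀ ⟨
          s₀ * 1#             ≈⟨ *-congˡ v²β≈1 ⟨
          s₀ * (v * v * β)    ≈⟨ solve 3 (λ s₀ v β → s₀ :* (v :* v :* β) := s₀ :* v :* β :* v) refl s₀ v β ⟩
          s₀ * v * β * v      ∎)
          where
          v = ∏ generator S
          v≉0 = ∏-≉0 K independent S
          β = proj₁ (inverse (v * v) (*-≉0 v≉0 v≉0))
          v²β≈1 = proj₂ (inverse (v * v) (*-≉0 v≉0 v≉0))
          β∈K = inverse-closed (∏²∈K K square∈K S) v²β≈1

    decomposition : ∀ {n} (s : Fin n → Carrier) → (∀ i → s i * s i ∈ K) → ¬ ¬ Decomposition K s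
    decomposition {zero} s _ = return record
      { rank        = 0
      ; generator   = λ ()
      ; independent = record { square∈K = λ () ; ∏∈K⇒∅ = λ { [] _ → ≡.refl } }
      ; support     = λ ()
      ; scalar      = λ ()
      ; scalar∈K    = λ ()
      ; decomposes  = λ ()
      }
    decomposition {suc n} s s²∈K = do
      D ← decomposition (s ∘ suc) (s²∈K ∘ suc)
      yes s₀∈K·∏ ← ¬¬-excluded-middle
        where no s₀∉K·∏ → return (new-generator (s²∈K zero) D s₀∉K·∏)
      return (extend D s₀∈K·∏)

  infix 4 _≟ˢ_
  _≟ˢ_ : ∀ {m} → DecidableEquality (Subset m)
  _≟ˢ_ = ≡-dec Bool._≟_

  when : ∀ {a} {A : Set a} → Dec A → Carrier → Carrier
  when (yes _) x = x
  when (no _)  x = 0#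

  when-yes : ∀ {a} {A : Set a} (d : Dec A) {x} → A → when d x ≈ x
  when-yes (yes _) _  = refl
  when-yes (no ¬a) a  = contradiction a ¬a

  when-no : ∀ {a} {A : Set a} (d : Dec A) {x} → ¬ A → when d x ≈ 0#
  when-no (yes a) ¬a = contradiction a ¬a
  when-no (no _)  _  = refl

  when-⇔ : ∀ {a b} {A : Set a} {B : Set b} (d : Dec A) (d′ : Dec B) {x} → (A → B) → (B → A) → when d x ≈ when d′ x
  when-⇔ (yes _) (yes _) _   _   = refl
  when-⇔ (no _)  (no _)  _   _   = refl
  when-⇔ (yes a) (no ¬b) A→B _   = contradiction (A→B a) ¬b
  when-⇔ (no ¬a) (yes b) _   B→A = contradiction (B→A b) ¬a

  when-*ʳ : ∀ {a} {A : Set a} (d : Dec A) {x y} → when d x * y ≈ when d (x * y)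
  when-*ʳ (yes _) = refl
  when-*ʳ (no _)  = zeroˡ _

  -- The total coefficient of ∏ g S in  sum (λ i → c i * ∏ g (T i)).
  coefficient : ∀ {m n} → (Fin n → Subset m) → (Fin n → Carrier) → Subset m → Carrier
  coefficient T c S = sum (λ i → when (T i ≟ˢ S) (c i))

  coefficient∈K : ∀ {p m n} (K : Subfield G p) (T : Fin n → Subset m) {c} → (∀ i → c i ∈ K) →
                  ∀ S → coefficient T c S ∈ K
  coefficient∈K K T c∈K S = sum-closed (λ i → when∈K (T i ≟ˢ S) (c∈K i))
    where
    open Subfield K
    open SubfieldProperties K
    when∈K : ∀ {a} {A : Set a} (d : Dec A) {x} → x ∈ K → when d x ∈ K
    when∈K (yes _) x∈K = x∈K
    when∈K (no _)  _   = 0∈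

  module SplitFirst (2≉0 : CharNot2 G) {p m} {K : Subfield G p} {g : Fin (suc m) → Carrier} (ind : IndependentSqrts K g) where
    open Subfield K
    open IndependentSqrts ind

    u = g zero

    u∉K : u ∉ K
    u∉K u∈K = contradiction (∏∈K⇒∅ (inside ∷ ∅) (∈-resp-≈ u≈∏ u∈K)) λ ()
      where
      u≈∏ : u ≈ ∏ g (inside ∷ ∅)
      u≈∏ = sym (trans (*-congˡ (∏-∅ (g ∘ suc))) (*-identityʳ u))

    open Adjoin K (square∈K zero) u∉K public using (K[u]; x≈x+0u; coordinates-unique; ∈K⇒hasCoordinates; x²∈K⇒x∈K⊎ux∈K)

    independent : IndependentSqrts K[u] (g ∘ suc)
    independent = record
      { square∈K = ∈K⇒hasCoordinates ∘ square∈K ∘ suc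
      ; ∏∈K⇒∅    = λ S v∈K[u] → decidable-stable (S ≟ˢ ∅) (do
          inj₁ v∈K ← x²∈K⇒x∈K⊎ux∈K 2≉0 v∈K[u] (∏²∈K K (square∈K ∘ suc) S)
            where inj₂ uv∈K → contradiction (∏∈K⇒∅ (inside ∷ S) uv∈K) λ ()
          return (∷-injectiveʳ (∏∈K⇒∅ (outside ∷ S) v∈K)))
      }

    absorb : Subset (suc m) → Carrier → Carrier
    absorb (inside  ∷ _) x = x * u
    absorb (outside ∷ _) x = x

    absorb-∈K[u] : ∀ S {x} → x ∈ K → absorb S x ∈ K[u]
    absorb-∈K[u] (inside  ∷ _) {x} x∈K = 0# , x , 0∈ , x∈K , sym (+-identityˡ (x * u))
    absorb-∈K[u] (outside ∷ _) x∈K     = ∈K⇒hasCoordinates x∈K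

    absorb-∏ : ∀ S x → x * ∏ g S ≈ absorb S x * ∏ (g ∘ suc) (tail S)
    absorb-∏ (inside  ∷ S) x = sym (*-assoc x u (∏ (g ∘ suc) S))
    absorb-∏ (outside ∷ S) x = refl

    absorb-when : ∀ S S′ x → when (tail S ≟ˢ S′) (absorb S x) ≈
                             when (S ≟ˢ outside ∷ S′) x + when (S ≟ˢ inside ∷ S′) x * u
    absorb-when (outside ∷ S) S′ x = begin
      when (S ≟ˢ S′) x
        ≈⟨ when-⇔ (S ≟ˢ S′) (outside ∷ S ≟ˢ outside ∷ S′) (≡.cong (outside ∷_)) ∷-injectiveʳ ⟩
      when (outside ∷ S ≟ˢ outside ∷ S′) x
        ≈⟨ x≈x+0u _ ⟩
      when (outside ∷ S ≟ˢ outside ∷ S′) x + 0# * u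
        ≈⟨ +-congˡ (*-congʳ (when-no (outside ∷ S ≟ˢ inside ∷ S′) {x} λ ())) ⟨
      when (outside ∷ S ≟ˢ outside ∷ S′) x + when (outside ∷ S ≟ˢ inside ∷ S′) x * u
        ∎
    absorb-when (inside ∷ S) S′ x = begin
      when (S ≟ˢ S′) (x * u)
        ≈⟨ when-⇔ (S ≟ˢ S′) (inside ∷ S ≟ˢ inside ∷ S′) (≡.cong (inside ∷_)) ∷-injectiveʳ ⟩
      when (inside ∷ S ≟ˢ inside ∷ S′) (x * u)
        ≈⟨ when-*ʳ (inside ∷ S ≟ˢ inside ∷ S′) ⟨
      when (inside ∷ S ≟ˢ inside ∷ S′) x * u
        ≈⟨ +-identityˡ _ ⟨
      0# + when (inside ∷ S ≟ˢ inside ∷ S′) x * u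
        ≈⟨ +-congʳ (when-no (inside ∷ S ≟ˢ outside ∷ S′) {x} λ ()) ⟨
      when (inside ∷ S ≟ˢ outside ∷ S′) x + when (inside ∷ S ≟ˢ inside ∷ S′) x * u
        ∎

    coefficient-split : ∀ {n} (T : Fin n → Subset (suc m)) c S′ →
                        coefficient (tail ∘ T) (λ i → absorb (T i) (c i)) S′ ≈
                        coefficient T c (outside ∷ S′) + coefficient T c (inside ∷ S′) * u
    coefficient-split T c S′ = begin
      sum (λ i → when (tail (T i) ≟ˢ S′) (absorb (T i) (c i)))
        ≈⟨ sum-cong-≋ (λ i → absorb-when (T i) S′ (c i)) ⟩
      sum (λ i → when (T i ≟ˢ outside ∷ S′) (c i) + when (T i ≟ˢ inside ∷ S′) (c i) * u)
        ≈⟨ ∑-distrib-+ (λ i → when (T i ≟ˢ outside ∷ S′) (c i)) (λ i → when (T i ≟ˢ inside ∷ S′) (c i) * u) ⟩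
      coefficient T c (outside ∷ S′) + sum (λ i → when (T i ≟ˢ inside ∷ S′) (c i) * u)
        ≈⟨ +-congˡ (*-distribʳ-sum u (λ i → when (T i ≟ˢ inside ∷ S′) (c i))) ⟨
      coefficient T c (outside ∷ S′) + coefficient T c (inside ∷ S′) * u
        ∎

  grouped-coefficients-vanish : CharNot2 G → ∀ {p m n} {K : Subfield G p} {g : Fin m → Carrier} → IndependentSqrts K g →
                                (T : Fin n → Subset m) (c : Fin n → Carrier) → (∀ i → c i ∈ K) →
                                sum (λ i → c i * ∏ g (T i)) ≈ 0# → ∀ S → ¬ ¬ coefficient T c S ≈ 0#
  grouped-coefficients-vanish _ {m = zero} {g = g} _ T c _ relation [] =
    return (trans (sum-cong-≋ (λ i → when-[] (T i) (c i))) relation)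
    where
    when-[] : ∀ S x → when (S ≟ˢ []) x ≈ x * ∏ g S
    when-[] [] x = sym (*-identityʳ x)
  grouped-coefficients-vanish 2≉0 {m = suc m} {K = K} {g} ind T c c∈K relation (b ∷ S) = do
    c′≈0 ← grouped-coefficients-vanish 2≉0 independent (tail ∘ T) c′ (λ i → absorb-∈K[u] (T i) (c∈K i)) relation′ S
    (outside≈0 , inside≈0) ← coordinates-unique (coefficient∈K K T c∈K _) (coefficient∈K K T c∈K _) 0∈ 0∈
                                (trans (sym (coefficient-split T c S)) (trans c′≈0 (x≈x+0u 0#)))
    return (at b outside≈0 inside≈0)
    where
    open Subfield K using (0∈)
    open SplitFirst 2≉0 ind
    c′ : Fin _ → Carrier
    c′ i = absorb (T i) (c i)
    relation′ : sum (λ i → c′ i * ∏ (g ∘ suc) (tail (T i))) ≈ 0#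
    relation′ = trans (sum-cong-≋ (λ i → sym (absorb-∏ (T i) (c i)))) relation
    at : ∀ b → coefficient T c (outside ∷ S) ≈ 0# → coefficient T c (inside ∷ S) ≈ 0# → coefficient T c (b ∷ S) ≈ 0#
    at outside o≈0 _ = o≈0
    at inside  _ i≈0 = i≈0

  sqrts-independent : CharNot2 G → ∀ {p n} (K : Subfield G p) (s : Fin n → Carrier) →
                      (∀ i → s i * s i ∈ K) → (∀ i → ¬ s i ≈ 0#) →
                      (∀ i j → i ≢ j → ∀ {a} → a ∈ K → ¬ s i ≈ a * s j) →
                      (c : Fin n → Carrier) → (∀ i → c i ∈ K) → sum (λ i → c i * s i) ≈ 0# → ∀ j → ¬ ¬ c j ≈ 0#
  sqrts-independent 2≉0 K s s²∈K s≉0 s-distinct c c∈K relation j = decomposition K s s²∈K >>= vanishes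
    where
    open Subfield K
    vanishes : Decomposition K s → ¬ ¬ c j ≈ 0#
    vanishes D = ¬¬-map cⱼ≈0 (grouped-coefficients-vanish 2≉0 independent support c·a c·a∈K relation′ (support j))
      where
      open Decomposition D
      c·a : Fin _ → Carrier
      c·a i = c i * scalar i
      c·a∈K : ∀ i → c·a i ∈ K
      c·a∈K i = *-closed (c∈K i) (scalar∈K i)
      relation′ : sum (λ i → c·a i * ∏ generator (support i)) ≈ 0#
      relation′ = trans (sum-cong-≋ (λ i → trans (*-assoc (c i) (scalar i) _) (*-congˡ (sym (decomposes i))))) relation
      scalar≉0 : ∀ i → ¬ scalar i ≈ 0#
      scalar≉0 i a≈0 = s≉0 i (trans (decomposes i) (trans (*-congʳ a≈0) (zeroˡ _)))
      support-injective : ∀ i → i ≢ j → support i ≢ support j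
      support-injective i i≢j Sᵢ≡Sⱼ = s-distinct i j i≢j aᵢaⱼ⁻¹∈K (begin
        s i                           ≈⟨ decomposes i ⟩
        aᵢ * ∏ generator (support i)  ≡⟨ ≡.cong (λ S → aᵢ * ∏ generator S) Sᵢ≡Sⱼ ⟩
        aᵢ * v                        ≈⟨ *-congʳ (*-identityʳ aᵢ) ⟨
        aᵢ * 1# * v                   ≈⟨ *-congʳ (*-congˡ aⱼaⱼ⁻¹≈1) ⟨
        aᵢ * (aⱼ * aⱼ⁻¹) * v          ≈⟨ solve 4 (λ aᵢ aⱼ aⱼ⁻¹ v → aᵢ :* (aⱼ :* aⱼ⁻¹) :* v := aᵢ :* aⱼ⁻¹ :* (aⱼ :* v))
                                                 refl aᵢ aⱼ aⱼ⁻¹ v ⟩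
        aᵢ * aⱼ⁻¹ * (aⱼ * v)          ≈⟨ *-congˡ (decomposes j) ⟨
        aᵢ * aⱼ⁻¹ * s j               ∎)
        where
        aᵢ = scalar i
        aⱼ = scalar j
        v = ∏ generator (support j)
        aⱼ⁻¹ = proj₁ (inverse aⱼ (scalar≉0 j))
        aⱼaⱼ⁻¹≈1 = proj₂ (inverse aⱼ (scalar≉0 j))
        aᵢaⱼ⁻¹∈K = *-closed (scalar∈K i) (inverse-closed (scalar∈K j) aⱼaⱼ⁻¹≈1)
      coefficient≈ : coefficient support c·a (support j) ≈ c·a j
      coefficient≈ = trans (sum-single _ j (λ i i≢j → when-no (support i ≟ˢ support j) (support-injective i i≢j)))
                           (when-yes (support j ≟ˢ support j) ≡.refl)
      cⱼ≈0 : coefficient support c·a (support j) ≈ 0# → c j ≈ 0#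
      cⱼ≈0 coefficient≈0 =
        x≉0⇒x*y≈0⇒y≈0 (scalar≉0 j) (trans (*-comm (scalar j) (c j)) (trans (sym coefficient≈) coefficient≈0))

module LinearAlgebra {c ℓ} (F : Field c ℓ) where
  open Field F hiding (zero)
  open FieldProperties F

  -- v i l is the l-th coordinate of the i-th vector.
  LinearlyDependent : ∀ {k m} → (Fin k → Fin m → Carrier) → Set (c ⊔ ℓ)
  LinearlyDependent {k} v = Σ (Fin k → Carrier) λ d → (∃[ i ] ¬ d i ≈ 0#) × (∀ l → sum (λ i → d i * v i l) ≈ 0#)

  zero-or-nonzero : ∀ {m} (a : Fin m → Carrier) → ¬ ¬ ((∀ l → a l ≈ 0#) ⊎ ∃[ l ] ¬ a l ≈ 0#)
  zero-or-nonzero {zero}  a = return (inj₁ λ ())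
  zero-or-nonzero {suc m} a = do
    yes a₀≈0 ← ¬¬-excluded-middle
      where no a₀≉0 → return (inj₂ (zero , a₀≉0))
    inj₁ rest≈0 ← zero-or-nonzero (a ∘ suc)
      where inj₂ (l , aₗ≉0) → return (inj₂ (suc l , aₗ≉0))
    return (inj₁ λ { zero → a₀≈0 ; (suc l) → rest≈0 l })

  sum-*-+ : ∀ {n} (a x y : Fin n → Carrier) q →
            sum (λ i → a i * (x i + y i * q)) ≈ sum (λ i → a i * x i) + sum (λ i → a i * y i) * q
  sum-*-+ a x y q = begin
    sum (λ i → a i * (x i + y i * q))                  ≈⟨ sum-cong-≋ (λ i → expand (a i) (x i) (y i)) ⟩
    sum (λ i → a i * x i + a i * y i * q)              ≈⟨ ∑-distrib-+ (λ i → a i * x i) (λ i → a i * y i * q) ⟩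
    sum (λ i → a i * x i) + sum (λ i → a i * y i * q)  ≈⟨ +-congˡ (*-distribʳ-sum q (λ i → a i * y i)) ⟨
    sum (λ i → a i * x i) + sum (λ i → a i * y i) * q  ∎
    where
    expand : ∀ a x y → a * (x + y * q) ≈ a * x + a * y * q
    expand a x y = solve 4 (λ a x y q → a :* (x :+ y :* q) := a :* x :+ a :* y :* q) refl a x y q

  private
    first-vector-zero : ∀ {k m} (v : Fin (suc k) → Fin m → Carrier) → (∀ l → v zero l ≈ 0#) → LinearlyDependent v
    first-vector-zero {k} v v₀≈0 = (λ { zero → 1# ; (suc _) → 0# }) , (zero , λ 1≈0 → 0≉1 (sym 1≈0)) , λ l → begin
      1# * v zero l + sum (λ i → 0# * v (suc i) l)
        ≈⟨ +-cong (trans (*-identityˡ _) (v₀≈0 l)) (sum-zero {k} (λ i → zeroˡ (v (suc i) l))) ⟩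
      0# + 0#
        ≈⟨ +-identityˡ 0# ⟩
      0#
        ∎

    -- Gaussian elimination of coordinate l₀, pivoting on the first vector.
    module Elimination {k m} (v : Fin (suc k) → Fin (suc m) → Carrier) (l₀ : Fin (suc m)) (v₀l₀≉0 : ¬ v zero l₀ ≈ 0#) where
      p = proj₁ (inverse (v zero l₀) v₀l₀≉0)
      v₀l₀*p≈1 = proj₂ (inverse (v zero l₀) v₀l₀≉0)

      reduced : Fin k → Fin m → Carrier
      reduced i l = v (suc i) (punchIn l₀ l) + v (suc i) l₀ * - (p * v zero (punchIn l₀ l))

      lift : LinearlyDependent reduced → LinearlyDependent v
      lift (d , (i₀ , dᵢ₀≉0) , reduced-relation) = d′ , (suc i₀ , dᵢ₀≉0) , relation
        where
        T : Fin (suc m) → Carrier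
        T l = sum (λ i → d i * v (suc i) l)
        d₀ = - T l₀ * p
        d′ : Fin (suc k) → Carrier
        d′ zero    = d₀
        d′ (suc i) = d i
        relation : ∀ l → d₀ * v zero l + T l ≈ 0#
        relation l with l₀ ≟ᶠ l
        ... | yes ≡.refl = begin
          - T l₀ * p * v zero l₀ + T l₀
            ≈⟨ solve 3 (λ t p v → :- t :* p :* v :+ t := t :- t :* (v :* p)) refl (T l₀) p (v zero l₀) ⟩
          T l₀ - T l₀ * (v zero l₀ * p)
            ≈⟨ +-congˡ (-‿cong (trans (*-congˡ v₀l₀*p≈1) (*-identityʳ (T l₀)))) ⟩
          T l₀ - T l₀
            ≈⟨ -‿inverseʳ (T l₀) ⟩
          0#
            ∎
        ... | no l₀≢l = begin
          - T l₀ * p * v zero l + T l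
            ≈⟨ solve 4 (λ t₀ p v t → :- t₀ :* p :* v :+ t := t :+ t₀ :* (:- (p :* v))) refl (T l₀) p (v zero l) (T l) ⟩
          T l + T l₀ * - (p * v zero l)
            ≈⟨ sum-*-+ d (λ i → v (suc i) l) (λ i → v (suc i) l₀) (- (p * v zero l)) ⟨
          sum (λ i → d i * (v (suc i) l + v (suc i) l₀ * - (p * v zero l)))
            ≡⟨ ≡.cong (λ l′ → sum (λ i → d i * (v (suc i) l′ + v (suc i) l₀ * - (p * v zero l′)))) (punchIn-punchOut l₀≢l) ⟨
          sum (λ i → d i * reduced i (punchOut l₀≢l))
            ≈⟨ reduced-relation (punchOut l₀≢l) ⟩
          0#
            ∎

  ¬¬-dependent : ∀ {k m} → m < k → (v : Fin k → Fin m → Carrier) → ¬ ¬ LinearlyDependent v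
  ¬¬-dependent {suc k} {zero}  _         v = return (first-vector-zero v λ ())
  ¬¬-dependent {suc k} {suc m} (s≤s m<k) v = do
    inj₂ (l₀ , v₀l₀≉0) ← zero-or-nonzero (v zero)
      where inj₁ v₀≈0 → return (first-vector-zero v v₀≈0)
    ¬¬-map (lift v l₀ v₀l₀≉0) (¬¬-dependent m<k (reduced v l₀ v₀l₀≉0))
    where open Elimination

module ExtensionProperties {c₁ ℓ₁ c₂ ℓ₂} {F : Field c₁ ℓ₁} {G : Field c₂ ℓ₂} (E : Extension F G) where
  private
    module F where
      open Field F public
      open FieldProperties F public using (sum)
  open Field G hiding (zero)
  open FieldProperties G
  open LinearAlgebra F using (LinearlyDependent; ¬¬-dependent)
  open Extension E
  open RingMorphisms.IsRingHomomorphism ι-hom using (⟦⟧-cong; +-homo; *-homo; 0#-homo; 1#-homo; -‿homo)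

  ι-inverse : ∀ {f f′} → f F.* f′ F.≈ F.1# → ι f * ι f′ ≈ 1#
  ι-inverse {f} {f′} ff′≈1 = trans (sym (*-homo f f′)) (trans (⟦⟧-cong ff′≈1) 1#-homo)

  ι-≉0 : ∀ {f} → ¬ f F.≈ F.0# → ¬ ι f ≈ 0#
  ι-≉0 {f} f≉0 = x*y≈1⇒x≉0 (ι-inverse (proj₂ (F.inverse f f≉0)))

  ι-injective : ∀ {f f′} → ι f ≈ ι f′ → ¬ ¬ f F.≈ f′
  ι-injective {f} {f′} ιf≈ιf′ f≉f′ = ι-≉0 f-f′≉0 (begin
    ι (f F.- f′)       ≈⟨ +-homo f (F.- f′) ⟩
    ι f + ι (F.- f′)   ≈⟨ +-cong ιf≈ιf′ (-‿homo f′) ⟩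
    ι f′ - ι f′        ≈⟨ -‿inverseʳ (ι f′) ⟩
    0#                 ∎)
    where
    open import Algebra.Properties.Group F.+-group using (x∙y⁻¹≈ε⇒x≈y)
    f-f′≉0 : ¬ (f F.- f′) F.≈ F.0#
    f-f′≉0 = f≉f′ ∘ x∙y⁻¹≈ε⇒x≈y f f′

  ι-sum : ∀ {n} (f : Fin n → F.Carrier) → ι (F.sum f) ≈ sum (ι ∘ f)
  ι-sum {zero}  f = 0#-homo
  ι-sum {suc n} f = trans (+-homo (f zero) (F.sum (f ∘ suc))) (+-congˡ (ι-sum (f ∘ suc)))

  image : Subfield G (c₁ ⊔ ℓ₂)
  image = record
    { Member         = λ x → ∃[ f ] x ≈ ι f
    ; ∈-resp-≈       = λ { x≈y (f , x≈ιf) → f , trans (sym x≈y) x≈ιf }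
    ; 0∈             = F.0# , sym 0#-homo
    ; 1∈             = F.1# , sym 1#-homo
    ; +-closed       = λ { (f , x≈) (f′ , y≈) → f F.+ f′ , trans (+-cong x≈ y≈) (sym (+-homo f f′)) }
    ; -‿closed       = λ { (f , x≈) → F.- f , trans (-‿cong x≈) (sym (-‿homo f)) }
    ; *-closed       = λ { (f , x≈) (f′ , y≈) → f F.* f′ , trans (*-cong x≈ y≈) (sym (*-homo f f′)) }
    ; inverse-closed = inverse-closed
    }
    where
    inverse-closed : ∀ {x y} → ∃[ f ] x ≈ ι f → x * y ≈ 1# → ∃[ f ] y ≈ ι f
    inverse-closed {x} (f , x≈ιf) xy≈1 = proj₁ f⁻¹ , inverse-unique xy≈1 (trans (*-congʳ x≈ιf) (ι-inverse (proj₂ f⁻¹)))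
      where
      f≉0 : ¬ f F.≈ F.0#
      f≉0 f≈0 = x*y≈1⇒x≉0 xy≈1 (trans x≈ιf (trans (⟦⟧-cong f≈0) 0#-homo))
      f⁻¹ = F.inverse f f≉0

  spanned⇒dependent : ∀ {r k} (e : Fin r → Carrier) → (∀ g → ∃[ cs ] g ≈ linComb E cs e) → r < k →
                      (s : Fin k → Carrier) →
                      ¬ ¬ (Σ (Fin k → F.Carrier) λ d → (∃[ i ] ¬ d i F.≈ F.0#) × sum (λ i → ι (d i) * s i) ≈ 0#)
  spanned⇒dependent {r} {k} e spans r<k s = ¬¬-map relation-in-G (¬¬-dependent r<k C)
    where
    C : Fin k → Fin r → F.Carrier
    C i = proj₁ (spans (s i))
    s≈ : ∀ i → s i ≈ sum (λ l → ι (C i l) * e l)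
    s≈ i = trans (proj₂ (spans (s i))) (reflexive (Σ≡sum (λ l → ι (C i l) * e l)))
    relation-in-G : LinearlyDependent C → _
    relation-in-G (d , nontrivial , relations) = d , nontrivial , (begin
      sum (λ i → ι (d i) * s i)
        ≈⟨ sum-cong-≋ (λ i → trans (*-congˡ (s≈ i)) (*-distribˡ-sum (ι (d i)) (λ l → ι (C i l) * e l))) ⟩
      sum (λ i → sum (λ l → ι (d i) * (ι (C i l) * e l)))
        ≈⟨ ∑-comm (λ i l → ι (d i) * (ι (C i l) * e l)) ⟩
      sum (λ l → sum (λ i → ι (d i) * (ι (C i l) * e l)))
        ≈⟨ sum-cong-≋ (λ l → sum-cong-≋ (λ i → trans (sym (*-assoc _ _ _)) (*-congʳ (sym (*-homo (d i) (C i l)))))) ⟩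
      sum (λ l → sum (λ i → ι (d i F.* C i l) * e l))
        ≈⟨ sum-cong-≋ (λ l → *-distribʳ-sum (e l) (λ i → ι (d i F.* C i l))) ⟨
      sum (λ l → sum (λ i → ι (d i F.* C i l)) * e l)
        ≈⟨ sum-cong-≋ (λ l → *-congʳ (ι-sum (λ i → d i F.* C i l))) ⟨
      sum (λ l → ι (F.sum (λ i → d i F.* C i l)) * e l)
        ≈⟨ sum-zero (λ l → trans (*-congʳ (trans (⟦⟧-cong (relations l)) 0#-homo)) (zeroˡ (e l))) ⟩
      0#
        ∎)

  same-square-class : ∀ {a b s t μ} → ¬ a F.≈ F.0# → s * s ≈ ι a → t * t ≈ ι b → s ≈ ι μ * t →
                      ¬ ¬ SameSquareClass F a b
  same-square-class {a} {b} {s} {t} {μ} a≉0 s²≈ιa t²≈ιb s≈μt = ¬¬-map (λ a≈ → μ , μ≉0 , a≈) (ι-injective ιa≈)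
    where
    ιa≈ : ι a ≈ ι (b F.* (μ F.* μ))
    ιa≈ = begin
      ι a                      ≈⟨ s²≈ιa ⟨
      s * s                    ≈⟨ *-cong s≈μt s≈μt ⟩
      ι μ * t * (ι μ * t)      ≈⟨ solve 2 (λ m t → m :* t :* (m :* t) := t :* t :* (m :* m)) refl (ι μ) t ⟩
      t * t * (ι μ * ι μ)      ≈⟨ *-cong t²≈ιb (sym (*-homo μ μ)) ⟩
      ι b * ι (μ F.* μ)        ≈⟨ *-homo b (μ F.* μ) ⟨
      ι (b F.* (μ F.* μ))      ∎
    μ≉0 : ¬ μ F.≈ F.0#
    μ≉0 μ≈0 = ι-≉0 a≉0 (trans (sym s²≈ιa) (trans (*-congʳ s≈0) (zeroˡ s)))
      where
      s≈0 : s ≈ 0#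
      s≈0 = trans s≈μt (trans (*-congʳ (trans (⟦⟧-cong μ≈0) 0#-homo)) (zeroˡ t))

lemma6p4 : ∀ {c₁ ℓ₁ c₂ ℓ₂ : Level} (F : Field c₁ ℓ₁) (G : Field c₂ ℓ₂) → CharNot2 F → CharNot2 G → (E : Extension F G) → (r : ℕ) → HasDegree E r → CardV≤ E r
lemma6p4 F G _ 2≉0 E r (e , spans , _) k a a∈V distinct with k ≤? r
... | yes k≤r = k≤r
... | no  k≰r = ⊥-elim (spanned⇒dependent e spans (≰⇒> k≰r) s λ (d , (j , dⱼ≉0) , relation) →
                  sqrts-independent 2≉0 image s s²∈image s≉0 s-distinct (ι ∘ d) (λ i → d i , refl) relation j (ι-≉0 dⱼ≉0))
  where
  open Field G
  open Extension E
  open ExtensionProperties E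
  open SquareRoots G
  s : Fin k → Carrier
  s i = proj₁ (proj₂ (a∈V i))
  s²≈ιa : ∀ i → s i * s i ≈ ι (a i)
  s²≈ιa i = proj₂ (proj₂ (a∈V i))
  s²∈image : ∀ i → s i * s i ∈ image
  s²∈image i = a i , s²≈ιa i
  s≉0 : ∀ i → ¬ s i ≈ 0#
  s≉0 i s≈0 = ι-≉0 (proj₁ (a∈V i)) (trans (sym (s²≈ιa i)) (trans (*-congʳ s≈0) (zeroˡ (s i))))
  s-distinct : ∀ i j → i ≢ j → ∀ {x} → x ∈ image → ¬ s i ≈ x * s j
  s-distinct i j i≢j (μ , x≈ιμ) sᵢ≈xsⱼ =
    same-square-class (proj₁ (a∈V i)) (s²≈ιa i) (s²≈ιa j) (trans sᵢ≈xsⱼ (*-congʳ x≈ιμ)) (distinct i j i≢j)
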